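{- Let $\mathcal L$ be a cubic algebra and $a\in\mathcal L$. If $b,c\ge a$, then $b\sim c$ if and only if $b=c$.
   Context: A cubic algebra is a join-semilattice $\mathcal L$ with top $\mathbf 1$ and a binary operation $\Delta$ such that: if $x\le y$ then $\Delta(y,x)\vee x=y$; if $x\le y\le z$ then $\Delta(z,\Delta(y,x))=\Delta(\Delta(z,y),\Delta(z,x))$; if $x\le y$ then $\Delta(y,\Delta(y,x))=x$; if $x\le y\le z$ then $\Delta(z,x)\le\Delta(z,y)$; and with $xy:=\Delta(\mathbf 1,\Delta(x\vee y,y))\vee y$ one has $(xy)y=x\vee y$ and $x(yz)=y(xz)$. For $a,b\in\mathcal L$, $a\sim b$ iff $\Delta(a\vee b,a)=b$. -}

module Defs where

open import Level using (Level; suc; _⊔_)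
open import Relation.Binary.PropositionalEquality using (_≡_)
open import Relation.Binary.Core using (Rel)
open import Relation.Binary.Definitions using (Maximum)
open import Relation.Binary.Lattice.Structures using (IsJoinSemilattice)
open import Algebra.Core using (Op₂)

record CubicAlgebra (c ℓ : Level) : Set (suc (c ⊔ ℓ)) where
  infixr 6 _∨_
  infix 4 _≤_
  field
    Carrier : Set c
    _≤_     : Rel Carrier ℓ
    _∨_     : Op₂ Carrier
    𝟏       : Carrier
    Δ       : Op₂ Carrier
    isJoinSemilattice : IsJoinSemilattice _≡_ _≤_ _∨_
    𝟏-top   : Maximum _≤_ 𝟏

  _·_ : Op₂ Carrier
  x · y = Δ 𝟏 (Δ (x ∨ y) y) ∨ y

  infixl 7 _·_

  field
    ax1 : ∀ {x y} → x ≤ y → Δ y x ∨ x ≡ y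
    ax2 : ∀ {x y z} → x ≤ y → y ≤ z → Δ z (Δ y x) ≡ Δ (Δ z y) (Δ z x)
    ax3 : ∀ {x y} → x ≤ y → Δ y (Δ y x) ≡ x
    ax4 : ∀ {x y z} → x ≤ y → y ≤ z → Δ z x ≤ Δ z y
    ax5 : ∀ x y → (x · y) · y ≡ x ∨ y
    ax6 : ∀ x y z → x · (y · z) ≡ y · (x · z)

  _∼_ : Carrier → Carrier → Set c
  a ∼ b = Δ (a ∨ b) a ≡ b

module Submission where

-- Write e = b ∨ c.  If b ∼ c, i.e. Δ(e, b) = c, then the
-- involution axiom ax3 gives Δ(e, c) = b as well, so Δ(e, –) swaps b and c.
-- Monotonicity (ax4) applied to a ≤ b ≤ e and a ≤ c ≤ e puts Δ(e, a) below
-- both c and b; together with a itself this bounds Δ(e, a) ∨ a, which equals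
-- e by ax1.  Hence e ≤ b and e ≤ c, so b = e = c.  Conversely every element
-- is ∼-related to itself, because Δ(b, b) = b: ax1 gives Δ(b, b) ≤ b and
-- ax3 with ax4 give the reverse inequality.

open import Defs
open import Relation.Binary.PropositionalEquality
  using (_≡_; refl; sym; trans; subst; cong)
open import Data.Product using (_×_; _,_)
open import Relation.Binary.Lattice.Structures using (IsJoinSemilattice)

module CubicFacts {c ℓ} (L : CubicAlgebra c ℓ) where
  open CubicAlgebra L
  open IsJoinSemilattice isJoinSemilattice
    renaming (refl to ≤-refl; trans to ≤-trans)

  -- By ax1, z = Δ(z, x) ∨ x for x ≤ z, so any common upper bound of
  -- Δ(z, x) and x lies above z.
  Δ-∨-bound : ∀ {x z w} → x ≤ z → Δ z x ≤ w → x ≤ w → z ≤ w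
  Δ-∨-bound {x} {z} {w} x≤z Δ≤w x≤w =
    subst (_≤ w) (ax1 x≤z) (∨-least Δ≤w x≤w)

  Δ-below : ∀ {x z} → x ≤ z → Δ z x ≤ z
  Δ-below {x} {z} x≤z = subst (Δ z x ≤_) (ax1 x≤z) (x≤x∨y (Δ z x) x)

  -- Since Δ(z, –) is an involution below z (ax3), Δ(z, x) = y forces
  -- Δ(z, y) = x.
  Δ-swap : ∀ {x y z} → x ≤ z → Δ z x ≡ y → Δ z y ≡ x
  Δ-swap {x} {y} {z} x≤z Δzx≡y = trans (cong (Δ z) (sym Δzx≡y)) (ax3 x≤z)

  -- Δ(x, x) = x: ax1 gives Δ(x, x) ≤ x; ax4 applied to Δ(x, x) ≤ x ≤ x
  -- gives Δ(x, Δ(x, x)) ≤ Δ(x, x), and the left side is x by ax3.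
  Δ-diagonal : ∀ x → Δ x x ≡ x
  Δ-diagonal x = antisym Δxx≤x x≤Δxx
    where
    Δxx≤x : Δ x x ≤ x
    Δxx≤x = Δ-below ≤-refl

    x≤Δxx : x ≤ Δ x x
    x≤Δxx = subst (_≤ Δ x x) (ax3 ≤-refl) (ax4 Δxx≤x ≤-refl)

  ∨-idem : ∀ x → x ∨ x ≡ x
  ∨-idem x = antisym (∨-least ≤-refl ≤-refl) (x≤x∨y x x)

  ∼-refl : ∀ x → x ∼ x
  ∼-refl x = subst (λ t → Δ t x ≡ x) (sym (∨-idem x)) (Δ-diagonal x)

  ∼-above⇒≡ : ∀ {a b c} → a ≤ b → a ≤ c → b ∼ c → b ≡ c
  ∼-above⇒≡ {a} {b} {c} a≤b a≤c b∼c = trans (antisym b≤e e≤b) (antisym e≤c c≤e)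
    where
    e = b ∨ c
    b≤e = x≤x∨y b c
    c≤e = y≤x∨y b c
    a≤e = ≤-trans a≤b b≤e

    Δea≤c : Δ e a ≤ c
    Δea≤c = subst (Δ e a ≤_) b∼c (ax4 a≤b b≤e)

    Δea≤b : Δ e a ≤ b
    Δea≤b = subst (Δ e a ≤_) (Δ-swap b≤e b∼c) (ax4 a≤c c≤e)

    e≤b : e ≤ b
    e≤b = Δ-∨-bound a≤e Δea≤b a≤b

    e≤c : e ≤ c
    e≤c = Δ-∨-bound a≤e Δea≤c a≤c

lemma2p3 : ∀ {c ℓ} (L : CubicAlgebra c ℓ) → let open CubicAlgebra L in
    ∀ (a b c : Carrier) → a ≤ b → a ≤ c → (b ∼ c → b ≡ c) × (b ≡ c → b ∼ c)
lemma2p3 L a b c a≤b a≤c = ∼-above⇒≡ a≤b a≤c , λ { refl → ∼-refl b }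
  where open CubicFacts L
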